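{- Let $G$ be a 2-connected cubic graph and let $\gamma$ be a 6-cycle of $G$ with exactly one chord such that the four edges $e_1,e_2,e_3,e_4$ connecting $V(\gamma)$ to the rest of $G$ have four distinct endpoints $w_1,w_2,w_3,w_4$ outside $\gamma$, indexed in the cyclic order induced by $\gamma$. Then the edges of $G[V(\gamma)]$ do not simultaneously contain a cut of $G$ separating the vertex sets $\{w_1,w_2\}$ and $\{w_3,w_4\}$ and a second cut of $G$ separating the vertex sets $\{w_2,w_3\}$ and $\{w_1,w_4\}$. -}

module Defs where

open import Data.Nat using (ℕ; _≤_)
open import Data.Fin using (Fin; zero; suc; toℕ)
open import Data.Bool using (Bool; true; false)
open import Data.List using (length; filterᵇ; allFin)
open import Data.Product using (_×_; ∃; Σ)
open import Data.Sum using (_⊎_)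
open import Data.Unit using (⊤)
open import Relation.Binary.PropositionalEquality using (_≡_; _≢_)
open import Relation.Nullary using (¬_)

record Graph (n : ℕ) : Set where
  field
    adj     : Fin n → Fin n → Bool
    adj-sym : ∀ u v → adj u v ≡ adj v u
    irrefl  : ∀ u → adj u u ≡ false
open Graph public

module _ {n : ℕ} (G : Graph n) where

  Edge : Fin n → Fin n → Set
  Edge u v = adj G u v ≡ true

  degree : Fin n → ℕ
  degree v = length (filterᵇ (adj G v) (allFin n))

  Cubic : Set
  Cubic = ∀ v → degree v ≡ 3

  data Walk (ok : Fin n → Set) : Fin n → Fin n → Set where
    stop : ∀ {u} → ok u → Walk ok u u
    step : ∀ {u v w} → ok u → Edge u v → Walk ok v w → Walk ok u w

  Connected : Set
  Connected = ∀ u v → Walk (λ _ → ⊤) u v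

  -- 2-connected: at least 3 vertices, connected, and no cut vertex
  TwoConnected : Set
  TwoConnected = (3 ≤ n) × Connected
               × (∀ x u v → u ≢ x → v ≢ x → Walk (λ y → y ≢ x) u v)

next6 : Fin 6 → Fin 6
next6 zero = suc zero
next6 (suc zero) = suc (suc zero)
next6 (suc (suc zero)) = suc (suc (suc zero))
next6 (suc (suc (suc zero))) = suc (suc (suc (suc zero)))
next6 (suc (suc (suc (suc zero)))) = suc (suc (suc (suc (suc zero))))
next6 (suc (suc (suc (suc (suc zero))))) = zero

Consec6 : Fin 6 → Fin 6 → Set
Consec6 i j = (j ≡ next6 i) ⊎ (i ≡ next6 j)

module _ {n : ℕ} (G : Graph n) (c : Fin 6 → Fin n) where

  IsSixCycle : Set
  IsSixCycle = (∀ i j → c i ≡ c j → i ≡ j) × (∀ i → Edge G (c i) (c (next6 i)))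

  Chord : Fin 6 → Fin 6 → Set
  Chord i j = (i ≢ j) × ¬ Consec6 i j × Edge G (c i) (c j)

  ExactlyOneChord : Set
  ExactlyOneChord = ∃ λ i → ∃ λ j → Chord i j ×
    (∀ k l → Chord k l → ((k ≡ i) × (l ≡ j)) ⊎ ((k ≡ j) × (l ≡ i)))

  OnCycle : Fin n → Set
  OnCycle v = ∃ λ i → c i ≡ v

  -- the edge cut δ(X) of G separates {a,b} from {a',b'} and all its
  -- edges are edges of G[V(γ)] (both endpoints on the cycle)
  CutInInducedSeparating : Fin n → Fin n → Fin n → Fin n → Set
  CutInInducedSeparating a b a' b' = Σ (Fin n → Bool) λ X →
    (X a ≡ true) × (X b ≡ true) × (X a' ≡ false) × (X b' ≡ false) ×
    (∀ u v → Edge G u v → X u ≡ true → X v ≡ false → OnCycle u × OnCycle v)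

-- The chord uses up the third edge at both of its endpoints, so the four
-- remaining cycle vertices each carry exactly one outside edge, namely e₁, …, e₄,
-- and no other edge joins V(γ) to the rest of G.  Both cuts consist of edges
-- of G[V(γ)], so the colourings X and Y defining them are constant on every
-- path outside γ.  Now w₁ is the only wₖ on the X-side of the first cut and
-- off the Y-side of the second.  A path from w₁ to γ avoiding the endpoint of
-- e₁ (which exists by 2-connectivity) leaves the outside of γ through some eₖ
-- and keeps the colours of w₁, hence k = 1: a contradiction.
module Submission where

open import Defs
open import Data.Nat using (ℕ; _<_; _≤_)
open import Data.Nat.Properties using (<-irrefl; <⇒≢)
open import Data.Fin using (Fin; zero; suc; toℕ)
open import Data.Fin.Properties using (_≟_; any?; <-cmp; injective⇒≤)
open import Data.Product using (_×_; _,_; ∃; proj₁; proj₂)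
open import Data.Sum using (_⊎_; inj₁; inj₂)
open import Data.Bool using (Bool; true; false; T)
open import Data.Unit using (tt)
open import Data.Empty using (⊥; ⊥-elim)
open import Data.List using (List; []; _∷_; length; lookup; tabulate)
open import Data.List.Membership.Propositional.Properties using (∈-lookup; ∈-filter⁺; ∈-allFin)
open import Data.List.Relation.Unary.Any using (index)
open import Data.List.Relation.Unary.Any.Properties using (lookup-index)
open import Data.List.Relation.Unary.All as All using (All; []; _∷_)
open import Data.List.Relation.Unary.All.Properties using (tabulate⁺)
open import Data.List.Relation.Unary.AllPairs using ([]; _∷_)
open import Data.List.Relation.Unary.Unique.Propositional using (Unique)
import Data.List.Relation.Unary.Unique.Propositional.Properties as Unique
open import Data.List.Relation.Binary.Subset.Propositional using (_⊆_)
open import Data.Bool.Properties using (T?)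
open import Function using (_∘_)
open import Relation.Binary.Definitions using (tri<; tri≈; tri>)
open import Relation.Binary.PropositionalEquality using (_≡_; _≢_; refl; sym; trans; cong; subst; ≢-sym)
open import Relation.Nullary using (¬_; yes; no; Dec; contradiction)

module _ {A : Set} where

  lookup-injective : ∀ {xs : List A} → Unique xs →
                     ∀ {i j} → lookup xs i ≡ lookup xs j → i ≡ j
  lookup-injective (_ ∷ _)       {zero}  {zero}  _  = refl
  lookup-injective (x≢xs ∷ _)    {zero}  {suc j} eq = contradiction eq (All.lookup x≢xs (∈-lookup j))
  lookup-injective (x≢xs ∷ _)    {suc i} {zero}  eq = contradiction (sym eq) (All.lookup x≢xs (∈-lookup i))
  lookup-injective (_ ∷ unique)  {suc i} {suc j} eq = cong suc (lookup-injective unique eq)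

  Unique∧⊆⇒length≤ : ∀ {xs ys : List A} → Unique ys → ys ⊆ xs → length ys ≤ length xs
  Unique∧⊆⇒length≤ {xs} {ys} unique ys⊆xs = injective⇒≤ {f = position} position-injective
    where
    position : Fin (length ys) → Fin (length xs)
    position k = index (ys⊆xs (∈-lookup k))

    position-injective : ∀ {k l} → position k ≡ position l → k ≡ l
    position-injective {k} {l} eq = lookup-injective unique (trans (lookup-index (ys⊆xs (∈-lookup k)))
      (trans (cong (lookup xs) eq) (sym (lookup-index (ys⊆xs (∈-lookup l))))))

strictlyIncreasing⇒injective : ∀ {m n} (f : Fin m → Fin n) →
  (∀ i j → toℕ i < toℕ j → toℕ (f i) < toℕ (f j)) → ∀ {i j} → f i ≡ f j → i ≡ j
strictlyIncreasing⇒injective f mono {i} {j} eq with <-cmp i j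
... | tri< i<j _ _ = contradiction (cong toℕ eq) (<⇒≢ (mono i j i<j))
... | tri≈ _ i≡j _ = i≡j
... | tri> _ _ j<i = contradiction (cong toℕ (sym eq)) (<⇒≢ (mono j i j<i))

module _ {n : ℕ} (G : Graph n) where

  Edge-sym : ∀ {u v} → Edge G u v → Edge G v u
  Edge-sym {u} {v} e = trans (adj-sym G v u) e

  distinctNeighbours≤degree : ∀ {v ys} → Unique ys → All (Edge G v) ys → length ys ≤ degree G v
  distinctNeighbours≤degree {v} unique edges = Unique∧⊆⇒length≤ unique
    (λ y∈ys → ∈-filter⁺ (T? ∘ adj G v) (∈-allFin _) (subst T (sym (All.lookup edges y∈ys)) tt))

  walk-first : ∀ {ok s t} → Walk G ok s t → ok s
  walk-first (stop ok-s)     = ok-s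
  walk-first (step ok-s _ _) = ok-s

  walk-last : ∀ {ok s t} → Walk G ok s t → ok t
  walk-last (stop ok-s)      = ok-s
  walk-last (step _ _ walk) = walk-last walk

  first-entry : ∀ {S ok : Fin n → Set} {s t} → (∀ v → Dec (S v)) → Walk G ok s t → ¬ S s → S t →
    ∃ λ u → ∃ λ v → Walk G (λ x → ¬ S x) s u × Edge G u v × S v × ok v
  first-entry S? (stop _) ¬Ss St = contradiction St ¬Ss
  first-entry {s = s} S? (step {v = v} _ e walk) ¬Ss St with S? v
  ... | yes Sv = s , v , stop ¬Ss , e , Sv , walk-first walk
  ... | no ¬Sv with first-entry S? walk ¬Sv St
  ...   | u , v′ , outside , e′ , Sv′ , ok-v′ = u , v′ , step ¬Ss e outside , e′ , Sv′ , ok-v′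

  CutWithin : (Fin n → Set) → (Fin n → Bool) → Set
  CutWithin S X = ∀ u v → Edge G u v → X u ≡ true → X v ≡ false → S u × S v

  cutWithin-constant-outside : ∀ {S : Fin n → Set} {X} → CutWithin S X →
    ∀ {s t} → Walk G (λ x → ¬ S x) s t → X s ≡ X t
  cutWithin-constant-outside cut (stop _) = refl
  cutWithin-constant-outside {S} {X} cut (step {u} {v} ¬Su e walk) =
    trans across (cutWithin-constant-outside cut walk)
    where
    across : X u ≡ X v
    across with X u in Xu | X v in Xv
    ... | true  | true  = refl
    ... | false | false = refl
    ... | true  | false = contradiction (proj₁ (cut u v e Xu Xv)) ¬Su
    ... | false | true  = contradiction (proj₂ (cut v u (Edge-sym e) Xv Xu)) ¬Su

prev6 : Fin 6 → Fin 6
prev6 zero                                = suc (suc (suc (suc (suc zero))))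
prev6 (suc zero)                          = zero
prev6 (suc (suc zero))                    = suc zero
prev6 (suc (suc (suc zero)))              = suc (suc zero)
prev6 (suc (suc (suc (suc zero))))        = suc (suc (suc zero))
prev6 (suc (suc (suc (suc (suc zero))))) = suc (suc (suc (suc zero)))

next6∘prev6 : ∀ i → next6 (prev6 i) ≡ i
next6∘prev6 zero                                = refl
next6∘prev6 (suc zero)                          = refl
next6∘prev6 (suc (suc zero))                    = refl
next6∘prev6 (suc (suc (suc zero)))              = refl
next6∘prev6 (suc (suc (suc (suc zero))))        = refl
next6∘prev6 (suc (suc (suc (suc (suc zero))))) = refl

next6≢prev6 : ∀ i → next6 i ≢ prev6 i
next6≢prev6 zero                                ()
next6≢prev6 (suc zero)                          ()
next6≢prev6 (suc (suc zero))                    ()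
next6≢prev6 (suc (suc (suc zero)))              ()
next6≢prev6 (suc (suc (suc (suc zero))))        ()
next6≢prev6 (suc (suc (suc (suc (suc zero))))) ()

module SixCycle {n : ℕ} (G : Graph n) (c : Fin 6 → Fin n) (cycle : IsSixCycle G c) where

  c-injective : ∀ {i j} → c i ≡ c j → i ≡ j
  c-injective = proj₁ cycle _ _

  edge-prev : ∀ i → Edge G (c i) (c (prev6 i))
  edge-prev i = Edge-sym G (subst (Edge G (c (prev6 i)) ∘ c) (next6∘prev6 i) (proj₂ cycle (prev6 i)))

  outside⇒≢ : ∀ {u} → ¬ OnCycle G c u → ∀ i → u ≢ c i
  outside⇒≢ ¬on i u≡ci = ¬on (i , sym u≡ci)

  onCycle? : ∀ v → Dec (OnCycle G c v)
  onCycle? v = any? (λ i → c i ≟ v)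

  Chord-sym : ∀ {i j} → Chord G c i j → Chord G c j i
  Chord-sym (i≢j , ¬consec , e) =
    ≢-sym i≢j , (λ { (inj₁ eq) → ¬consec (inj₂ eq) ; (inj₂ eq) → ¬consec (inj₁ eq) }) , Edge-sym G e

  module _ (cubic : Cubic G) where

    extraNeighbour-unique : ∀ {i x y} → Edge G (c i) x → Edge G (c i) y →
      x ≢ c (next6 i) → x ≢ c (prev6 i) → y ≢ c (next6 i) → y ≢ c (prev6 i) → x ≡ y
    extraNeighbour-unique {i} {x} {y} ex ey x≢next x≢prev y≢next y≢prev with x ≟ y
    ... | yes x≡y = x≡y
    ... | no x≢y = contradiction (subst (4 ≤_) (cubic (c i)) (distinctNeighbours≤degree G distinct edges))
                                 (<-irrefl refl)
      where
      distinct : Unique (c (next6 i) ∷ c (prev6 i) ∷ x ∷ y ∷ [])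
      distinct = (next6≢prev6 i ∘ c-injective ∷ ≢-sym x≢next ∷ ≢-sym y≢next ∷ [])
               ∷ (≢-sym x≢prev ∷ ≢-sym y≢prev ∷ [])
               ∷ (x≢y ∷ [])
               ∷ [] ∷ []
      edges : All (Edge G (c i)) (c (next6 i) ∷ c (prev6 i) ∷ x ∷ y ∷ [])
      edges = proj₂ cycle i ∷ edge-prev i ∷ ex ∷ ey ∷ []

    chordEndpoint-noOutsideNeighbour : ∀ {i j u} → Chord G c i j → Edge G (c i) u → ¬ OnCycle G c u → ⊥
    chordEndpoint-noOutsideNeighbour {i} {j} (_ , ¬consec , e) eu ¬on =
      outside⇒≢ ¬on j (extraNeighbour-unique eu e (outside⇒≢ ¬on _) (outside⇒≢ ¬on _) cj≢next cj≢prev)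
      where
      cj≢next : c j ≢ c (next6 i)
      cj≢next = ¬consec ∘ inj₁ ∘ c-injective
      cj≢prev : c j ≢ c (prev6 i)
      cj≢prev eq = ¬consec (inj₂ (trans (sym (next6∘prev6 i)) (cong next6 (sym (c-injective eq)))))

    module _ (p : Fin 4 → Fin 6) (p-injective : ∀ {k l} → p k ≡ p l → k ≡ l)
             (w : Fin 4 → Fin n) (outside : ∀ k → ¬ OnCycle G c (w k))
             (attached : ∀ k → Edge G (c (p k)) (w k))
             {i j : Fin 6} (chord : Chord G c i j) where

      attachment≢chordEndpoint : ∀ {i′ j′} → Chord G c i′ j′ → ∀ k → p k ≢ i′
      attachment≢chordEndpoint chord′ k refl = chordEndpoint-noOutsideNeighbour chord′ (attached k) (outside k)

      position-attachmentOrChordEndpoint : ∀ l → (∃ λ k → p k ≡ l) ⊎ (l ≡ i ⊎ l ≡ j)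
      position-attachmentOrChordEndpoint l with any? (λ k → p k ≟ l) | l ≟ i | l ≟ j
      ... | yes attachment | _       | _       = inj₁ attachment
      ... | no _           | yes l≡i | _       = inj₂ (inj₁ l≡i)
      ... | no _           | no _    | yes l≡j = inj₂ (inj₂ l≡j)
      ... | no l∉p         | no l≢i  | no l≢j  =
        contradiction (Unique∧⊆⇒length≤ distinct (λ {x} _ → ∈-allFin x)) (<-irrefl refl)
        where
        distinct : Unique (i ∷ j ∷ l ∷ tabulate p)
        distinct = (proj₁ chord ∷ ≢-sym l≢i ∷ tabulate⁺ (≢-sym ∘ attachment≢chordEndpoint chord))
                 ∷ (≢-sym l≢j ∷ tabulate⁺ (≢-sym ∘ attachment≢chordEndpoint (Chord-sym chord)))
                 ∷ tabulate⁺ (λ k l≡pk → l∉p (k , sym l≡pk))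
                 ∷ Unique.tabulate⁺ p-injective

      outsideNeighbour⇒attachment : ∀ {l u} → Edge G (c l) u → ¬ OnCycle G c u →
        ∃ λ k → p k ≡ l × u ≡ w k
      outsideNeighbour⇒attachment {l} eu ¬on with position-attachmentOrChordEndpoint l
      ... | inj₁ (k , refl) = k , refl ,
        extraNeighbour-unique eu (attached k) (outside⇒≢ ¬on _) (outside⇒≢ ¬on _)
                                              (outside⇒≢ (outside k) _) (outside⇒≢ (outside k) _)
      ... | inj₂ (inj₁ refl) = ⊥-elim (chordEndpoint-noOutsideNeighbour chord eu ¬on)
      ... | inj₂ (inj₂ refl) = ⊥-elim (chordEndpoint-noOutsideNeighbour (Chord-sym chord) eu ¬on)

      enters-through-attachment : ∀ {ok : Fin n → Set} {s t} → Walk G ok s t → ¬ OnCycle G c s → OnCycle G c t →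
        ∃ λ k → ok (c (p k)) × Walk G (λ x → ¬ OnCycle G c x) s (w k)
      enters-through-attachment walk ¬on-s on-t with first-entry G onCycle? walk ¬on-s on-t
      ... | _ , _ , path , e , (l , refl) , ok-v
          with outsideNeighbour⇒attachment (Edge-sym G e) (walk-last G path)
      ...   | k , refl , refl = k , ok-v , path

mainTheorem10 : {n : ℕ} (G : Graph n) → Cubic G → TwoConnected G →
    (c : Fin 6 → Fin n) → IsSixCycle G c → ExactlyOneChord G c →
    (p : Fin 4 → Fin 6) → (∀ i j → toℕ i < toℕ j → toℕ (p i) < toℕ (p j)) →
    (w : Fin 4 → Fin n) → (∀ i j → w i ≡ w j → i ≡ j) →
    (∀ k → ¬ OnCycle G c (w k)) → (∀ k → Edge G (c (p k)) (w k)) →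
    ¬ (CutInInducedSeparating G c (w zero) (w (suc zero)) (w (suc (suc zero))) (w (suc (suc (suc zero))))
    × CutInInducedSeparating G c (w (suc zero)) (w (suc (suc zero))) (w zero) (w (suc (suc (suc zero)))))
mainTheorem10 G cubic (_ , _ , avoidable) c cycle (_ , _ , chord , _) p increasing w _ outside attached
  ((X , X₀ , _ , X₂ , X₃ , cutX) , (Y , Y₁ , _ , Y₀ , _ , cutY)) =
  ¬reentry-elsewhere
    (enters-through-attachment cubic p p-injective w outside attached chord
      (avoidable (c (p zero)) (w zero) (c (p (suc zero))) (outside⇒≢ (outside zero) _) cp₁≢cp₀)
      (outside zero) (p (suc zero) , refl))
  where
  open SixCycle G c cycle

  p-injective : ∀ {k l} → p k ≡ p l → k ≡ l
  p-injective = strictlyIncreasing⇒injective p increasing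

  cp₁≢cp₀ : c (p (suc zero)) ≢ c (p zero)
  cp₁≢cp₀ eq with p-injective (c-injective eq)
  ... | ()

  colours⇒attachment₀ : ∀ k → X (w k) ≡ true → Y (w k) ≡ false → k ≡ zero
  colours⇒attachment₀ zero                   _  _  = refl
  colours⇒attachment₀ (suc zero)             _  Yk = contradiction (trans (sym Y₁) Yk) λ ()
  colours⇒attachment₀ (suc (suc zero))       Xk _  = contradiction (trans (sym Xk) X₂) λ ()
  colours⇒attachment₀ (suc (suc (suc zero))) Xk _  = contradiction (trans (sym Xk) X₃) λ ()

  ¬reentry-elsewhere : (∃ λ k → c (p k) ≢ c (p zero) × Walk G (λ x → ¬ OnCycle G c x) (w zero) (w k)) → ⊥
  ¬reentry-elsewhere (k , avoids , path) = avoids (cong (c ∘ p) (colours⇒attachment₀ k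
    (trans (sym (cutWithin-constant-outside G cutX path)) X₀)
    (trans (sym (cutWithin-constant-outside G cutY path)) Y₀)))
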